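{- Let $G=(V,E)$ be a directed graph and $G_h=(V_h,E_h)$ a subgraph of $G$. Let $W_h\subseteq V_h$ be a set of white vertices such that every $u\in W_h$ has exactly the same incoming edges in $G_h$ as in $G$, and let $B_h=V_h\setminus W_h$. Then a set $T\subseteq W_h$ induces a top SCC in $G_h$ if and only if it induces a top SCC in $G$. If moreover $B_h\neq\emptyset$, then $T\subseteq W_h$ induces a top SCC in the graph $G'_h$ if and only if it induces a top SCC in $G$.
   Context: A top SCC (tSCC) of a graph is a strongly connected component with no incoming edges from vertices outside it. The graph $G'_h$ with root $r_h$ is defined as follows: if $|B_h|\ge 2$, $G'_h$ is $G_h$ together with a new vertex $r_h$ and an edge from $r_h$ to each vertex of $B_h$; if $|B_h|=1$, $r_h$ is the unique vertex of $B_h$ and $G'_h=G_h$. -}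

module Defs where

open import Data.Nat using (ℕ; suc)
open import Data.Fin using (Fin; zero; suc)
open import Data.Fin.Subset using (Subset; _∈_; _∉_; _⊆_; _─_; Nonempty; inside; outside)
open import Data.Vec using (_∷_)
open import Data.Product using (_×_)
open import Data.Empty using (⊥)
open import Relation.Binary.Construct.Closure.ReflexiveTransitive using (Star)

-- A directed graph on (a subset S of) the vertex universe Fin n:
-- vertex set S, edge relation E (only edges with both ends in S count).
EdgeRel : ℕ → Set₁
EdgeRel n = Fin n → Fin n → Set

Edge : ∀ {n} → Subset n → EdgeRel n → EdgeRel n
Edge S E u v = u ∈ S × v ∈ S × E u v

Reach : ∀ {n} → Subset n → EdgeRel n → EdgeRel n
Reach S E = Star (Edge S E)

IsSCC : ∀ {n} → Subset n → EdgeRel n → Subset n → Set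
IsSCC {n} S E T =
  T ⊆ S × Nonempty T
  × (∀ {u v} → u ∈ T → v ∈ T → Reach S E u v)
  × (∀ {u v} → u ∈ T → v ∈ S → Reach S E u v → Reach S E v u → v ∈ T)

IsTopSCC : ∀ {n} → Subset n → EdgeRel n → Subset n → Set
IsTopSCC S E T = IsSCC S E T × (∀ {u v} → Edge S E u v → v ∈ T → u ∈ T)

Full : ∀ {n} → Subset n
Full = Data.Fin.Subset.⊤

IsSubgraph : ∀ {n} → EdgeRel n → Subset n → EdgeRel n → Set
IsSubgraph E Vh Eh = ∀ {u v} → Eh u v → E u v × u ∈ Vh × v ∈ Vh

-- G'_h in the case |B_h| ≥ 2: vertex set Fin (suc n), new root r_h = zero,
-- old vertex v is suc v, with edges r_h → b for every b ∈ B_h.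
augVertices : ∀ {n} → Subset n → Subset (suc n)
augVertices Vh = inside ∷ Vh

augEdges : ∀ {n} → Subset n → EdgeRel n → EdgeRel (suc n)
augEdges Bh Eh zero    zero    = ⊥
augEdges Bh Eh zero    (suc v) = v ∈ Bh
augEdges Bh Eh (suc u) zero    = ⊥
augEdges Bh Eh (suc u) (suc v) = Eh u v

liftSet : ∀ {n} → Subset n → Subset (suc n)
liftSet T = outside ∷ T

-- A top SCC T is closed under incoming edges, so every path ending in T stays
-- inside T and uses only edges into T. Hence whether T is a top SCC depends only
-- on the edges entering T, and white vertices have the same incoming edges in G_h
-- as in G. For G'_h the new root only has edges into B_h, which is disjoint from T.
module Submission where

open import Defs
open import Data.Nat using (ℕ; _≤_)
open import Data.Fin using (zero; suc)
open import Data.Fin.Subset using (Subset; _∈_; _∉_; _⊆_; _─_; ∣_∣; Nonempty; inside; outside)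
open import Data.Fin.Subset.Properties using (∈⊤; drop-there)
open import Data.Vec using (_∷_)
open import Data.Vec.Base using (here; there)
open import Data.Product using (_×_; _,_; proj₁)
open import Data.Empty using (⊥-elim)
open import Function.Bundles using (_⇔_; mk⇔; Equivalence)
open import Function.Properties.Equivalence using () renaming (trans to ⇔-trans)
open import Relation.Binary.PropositionalEquality using (_≡_)
open import Relation.Binary.Construct.Closure.ReflexiveTransitive using (ε; _◅_; gmap)

x∈p─q⇒x∉q : ∀ {n} (p q : Subset n) {x} → x ∈ p ─ q → x ∉ q
x∈p─q⇒x∉q (_ ∷ p) (inside ∷ q) () here
x∈p─q⇒x∉q (_ ∷ p) (_ ∷ q) (there x∈p─q) (there x∈q) = x∈p─q⇒x∉q p q x∈p─q x∈q

module _ {n : ℕ} where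

  StronglyConnected : Subset n → EdgeRel n → Subset n → Set
  StronglyConnected S E T = ∀ {u v} → u ∈ T → v ∈ T → Reach S E u v

  NoIncoming : Subset n → EdgeRel n → Subset n → Set
  NoIncoming S E T = ∀ {u v} → Edge S E u v → v ∈ T → u ∈ T

  NoIncoming⇒Reach-closed : ∀ {S E T} → NoIncoming S E T
    → ∀ {x t} → Reach S E x t → t ∈ T → x ∈ T
  NoIncoming⇒Reach-closed noIn ε        t∈T = t∈T
  NoIncoming⇒Reach-closed noIn (e ◅ xs) t∈T = noIn e (NoIncoming⇒Reach-closed noIn xs t∈T)

  isTopSCC : ∀ {S E T} → T ⊆ S → Nonempty T → StronglyConnected S E T → NoIncoming S E T
    → IsTopSCC S E T
  isTopSCC T⊆S ne sc noIn =
    (T⊆S , ne , sc , λ u∈T _ _ v↝u → NoIncoming⇒Reach-closed noIn v↝u u∈T) , noIn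

  NoIncoming⇒Reach-transfer : ∀ {S E S′ E′ T} → NoIncoming S E T
    → (∀ {u v} → Edge S E u v → v ∈ T → Edge S′ E′ u v)
    → ∀ {x t} → Reach S E x t → t ∈ T → Reach S′ E′ x t
  NoIncoming⇒Reach-transfer noIn into ε        t∈T = ε
  NoIncoming⇒Reach-transfer noIn into (e ◅ xs) t∈T =
    into e (NoIncoming⇒Reach-closed noIn xs t∈T) ◅ NoIncoming⇒Reach-transfer noIn into xs t∈T

  SameIncoming : Subset n → EdgeRel n → Subset n → EdgeRel n → Subset n → Set
  SameIncoming S E S′ E′ T = ∀ {u v} → v ∈ T → Edge S E u v ⇔ Edge S′ E′ u v

  IsTopSCC-resp-SameIncoming : ∀ {S E S′ E′ T} → T ⊆ S′ → SameIncoming S E S′ E′ T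
    → IsTopSCC S E T → IsTopSCC S′ E′ T
  IsTopSCC-resp-SameIncoming T⊆S′ same ((_ , ne , sc , _) , noIn) =
    isTopSCC T⊆S′ ne
      (λ u∈T v∈T → NoIncoming⇒Reach-transfer noIn (λ e v∈T → Equivalence.to (same v∈T) e) (sc u∈T v∈T) v∈T)
      (λ e v∈T → noIn (Equivalence.from (same v∈T) e) v∈T)

  IsTopSCC-SameIncoming : ∀ {S E S′ E′ T} → T ⊆ S → T ⊆ S′ → SameIncoming S E S′ E′ T
    → IsTopSCC S E T ⇔ IsTopSCC S′ E′ T
  IsTopSCC-SameIncoming T⊆S T⊆S′ same = mk⇔
    (IsTopSCC-resp-SameIncoming T⊆S′ same)
    (IsTopSCC-resp-SameIncoming T⊆S λ v∈T → let open Equivalence (same v∈T) in mk⇔ from to)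

-- With the root zero left out of the vertex set, the extended graph is a renaming of (S , E).
module _ {n : ℕ} (S : Subset n) (B : Subset n) (E : EdgeRel n) where

  private
    S⁺ = outside ∷ S
    E⁺ = augEdges B E

  Reach-suc : ∀ {u v} → Reach S E u v → Reach S⁺ E⁺ (suc u) (suc v)
  Reach-suc = gmap suc λ (u∈S , v∈S , e) → there u∈S , there v∈S , e

  Reach-pred : ∀ {u v} → Reach S⁺ E⁺ (suc u) (suc v) → Reach S E u v
  Reach-pred ε = ε
  Reach-pred (_◅_ {j = suc _} (there u∈S , there w∈S , e) w↝v) = (u∈S , w∈S , e) ◅ Reach-pred w↝v

  IsTopSCC-liftSet : ∀ {T} → IsTopSCC S⁺ E⁺ (liftSet T) ⇔ IsTopSCC S E T
  IsTopSCC-liftSet {T} = mk⇔ to from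
    where
    to : IsTopSCC S⁺ E⁺ (liftSet T) → IsTopSCC S E T
    to ((T⁺⊆S⁺ , (suc x , there x∈T) , sc , _) , noIn) =
      isTopSCC (λ x∈T → drop-there (T⁺⊆S⁺ (there x∈T))) (x , x∈T)
        (λ u∈T v∈T → Reach-pred (sc (there u∈T) (there v∈T)))
        (λ (u∈S , v∈S , e) v∈T → drop-there (noIn (there u∈S , there v∈S , e) (there v∈T)))

    from : IsTopSCC S E T → IsTopSCC S⁺ E⁺ (liftSet T)
    from ((T⊆S , (x , x∈T) , sc , _) , noIn) = isTopSCC T⁺⊆S⁺ (suc x , there x∈T) sc⁺ noIn⁺
      where
      T⁺⊆S⁺ : liftSet T ⊆ S⁺
      T⁺⊆S⁺ {suc _} (there x∈T) = there (T⊆S x∈T)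

      sc⁺ : StronglyConnected S⁺ E⁺ (liftSet T)
      sc⁺ {suc _} {suc _} (there u∈T) (there v∈T) = Reach-suc (sc u∈T v∈T)

      noIn⁺ : NoIncoming S⁺ E⁺ (liftSet T)
      noIn⁺ {suc _} {suc _} (there u∈S , there v∈S , e) (there v∈T) = there (noIn (u∈S , v∈S , e) v∈T)

-- The root has edges only into B, so it cannot be an in-neighbour of T.
rootless-SameIncoming : ∀ {n} (S B : Subset n) (E : EdgeRel n) {T : Subset n}
  → (∀ {x} → x ∈ T → x ∉ B)
  → SameIncoming (inside ∷ S) (augEdges B E) (outside ∷ S) (augEdges B E) (liftSet T)
rootless-SameIncoming S B E T∩B=∅ {zero} {suc _} (there v∈T) =
  mk⇔ (λ (_ , _ , v∈B) → ⊥-elim (T∩B=∅ v∈T v∈B)) (λ ())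
rootless-SameIncoming S B E T∩B=∅ {suc _} {suc _} (there v∈T) = mk⇔ reroot reroot
  where
  reroot : ∀ {s s′ u v} → Edge (s ∷ S) (augEdges B E) (suc u) v → Edge (s′ ∷ S) (augEdges B E) (suc u) v
  reroot {v = suc _} (there u∈S , there v∈S , e) = there u∈S , there v∈S , e

mainTheorem5 : ∀ {n : ℕ} (E : EdgeRel n) (Vh : Subset n) (Eh : EdgeRel n) (Wh : Subset n)
    → IsSubgraph E Vh Eh
    → Wh ⊆ Vh
    → (∀ {u v} → u ∈ Wh → E v u → Eh v u)
    → ((T : Subset n) → T ⊆ Wh → IsTopSCC Vh Eh T ⇔ IsTopSCC Full E T)
      × (Nonempty (Vh ─ Wh)
         → ((2 ≤ ∣ Vh ─ Wh ∣ → (T : Subset n) → T ⊆ Wh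
               → IsTopSCC (augVertices Vh) (augEdges (Vh ─ Wh) Eh) (liftSet T) ⇔ IsTopSCC Full E T)
           × (∣ Vh ─ Wh ∣ ≡ 1 → (T : Subset n) → T ⊆ Wh
               → IsTopSCC Vh Eh T ⇔ IsTopSCC Full E T)))
mainTheorem5 {n} E Vh Eh Wh sub Wh⊆Vh sameIn = inGh , λ _ → inG′h , λ _ → inGh
  where
  whiteSameIncoming : SameIncoming Vh Eh Full E Wh
  whiteSameIncoming v∈Wh = mk⇔
    (λ (_ , _ , e) → ∈⊤ , ∈⊤ , proj₁ (sub e))
    (λ (_ , _ , e) → let (_ , u∈Vh , v∈Vh) = sub (sameIn v∈Wh e) in u∈Vh , v∈Vh , sameIn v∈Wh e)

  inGh : (T : Subset n) → T ⊆ Wh → IsTopSCC Vh Eh T ⇔ IsTopSCC Full E T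
  inGh T T⊆Wh = IsTopSCC-SameIncoming (λ x∈T → Wh⊆Vh (T⊆Wh x∈T)) (λ _ → ∈⊤) (λ v∈T → whiteSameIncoming (T⊆Wh v∈T))

  inG′h : 2 ≤ ∣ Vh ─ Wh ∣ → (T : Subset n) → T ⊆ Wh
    → IsTopSCC (augVertices Vh) (augEdges (Vh ─ Wh) Eh) (liftSet T) ⇔ IsTopSCC Full E T
  inG′h _ T T⊆Wh = ⇔-trans dropRoot (⇔-trans (IsTopSCC-liftSet Vh (Vh ─ Wh) Eh) (inGh T T⊆Wh))
    where
    liftT⊆ : ∀ {s} → liftSet T ⊆ s ∷ Vh
    liftT⊆ (there x∈T) = there (Wh⊆Vh (T⊆Wh x∈T))

    dropRoot : IsTopSCC (augVertices Vh) (augEdges (Vh ─ Wh) Eh) (liftSet T)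
             ⇔ IsTopSCC (outside ∷ Vh) (augEdges (Vh ─ Wh) Eh) (liftSet T)
    dropRoot = IsTopSCC-SameIncoming liftT⊆ liftT⊆
      (rootless-SameIncoming Vh (Vh ─ Wh) Eh λ x∈T x∈B → x∈p─q⇒x∉q Vh Wh x∈B (T⊆Wh x∈T))
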